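{- Let $G$ be an $n$-vertex prime graph of twin-width $1$, and let $G=G_n,\dots,G_2,G_1$ be a $1$-sequence of $G$. Then every trigraph $G_i$ has exactly one red edge, except $G_n$ and $G_1$, which have no red edge.
   Context: A module of $G$ is a set $S\subseteq V(G)$ such that every vertex outside $S$ is adjacent to all or none of $S$; it is trivial if it is a singleton or $V(G)$; $G$ is prime if it has no non-trivial module. Twin-width: a trigraph has disjoint black and red edge sets; a graph is a trigraph with no red edges. Contracting distinct $u,v$ into a new vertex $z$ makes vertices adjacent (by any edge) to exactly one of $u,v$ red neighbours of $z$, a common neighbour $x$ a black neighbour if $ux,vx$ are both black and red otherwise, other edges unchanged. A $d$-sequence of an $n$-vertex graph $G$ is a sequence $G=G_n,\dots,G_1$ of trigraphs of red degree at most $d$, each obtained from the previous by one contraction (so $G_i$ has $i$ vertices); the twin-width is the least $d$ for which one exists. -}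

module Defs where

open import Data.Nat using (ℕ; zero; suc; _+_; _≤_; _<_)
open import Data.Fin using (Fin; zero; suc)
open import Data.Bool using (Bool; true; false)
open import Data.Product using (Σ; ∃; _×_; _,_)
open import Data.Sum using (_⊎_)
open import Relation.Nullary using (¬_)
open import Relation.Binary.PropositionalEquality using (_≡_; _≢_)

record Graph (n : ℕ) : Set where
  field
    adj     : Fin n → Fin n → Bool
    adj-sym : ∀ x y → adj x y ≡ adj y x
    adj-irr : ∀ x → adj x x ≡ false
open Graph public

Subset : ℕ → Set
Subset n = Fin n → Bool

_∈ₛ_ : ∀ {n} → Fin n → Subset n → Set
x ∈ₛ S = S x ≡ true

-- S is a module: every vertex outside S is adjacent to all or none of S.
-- Modules are taken to be non-empty (standard convention).
IsModule : ∀ {n} → Graph n → Subset n → Set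
IsModule {n} G S =
  (∃ λ x → x ∈ₛ S) ×
  (∀ (z : Fin n) → ¬ (z ∈ₛ S) → ∀ a b → a ∈ₛ S → b ∈ₛ S → adj G z a ≡ adj G z b)

IsTrivial : ∀ {n} → Subset n → Set
IsTrivial {n} S =
  (∃ λ (x : Fin n) → ∀ y → (y ∈ₛ S → y ≡ x) × (y ≡ x → y ∈ₛ S))
  ⊎ (∀ (y : Fin n) → y ∈ₛ S)

IsPrime : ∀ {n} → Graph n → Set
IsPrime {n} G = ∀ (S : Subset n) → IsModule G S → IsTrivial S

data EdgeType : Set where
  none black red : EdgeType

record Trigraph (k : ℕ) : Set where
  field
    edge     : Fin k → Fin k → EdgeType
    edge-sym : ∀ x y → edge x y ≡ edge y x
    edge-irr : ∀ x → edge x x ≡ none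
open Trigraph public

toTri : ∀ {n} → Graph n → Fin n → Fin n → EdgeType
toTri G x y with adj G x y
... | true  = black
... | false = none

-- Edge of the contracted vertex z towards a vertex x, given the edges ux, vx.
merge : EdgeType → EdgeType → EdgeType
merge none  none  = none
merge black black = black
merge _     _     = red

isRed : EdgeType → Bool
isRed red = true
isRed _   = false

count : ∀ {k} → (Fin k → Bool) → ℕ
count {zero}  f = 0
count {suc k} f with f zero
... | true  = suc (count (λ i → f (suc i)))
... | false = count (λ i → f (suc i))

redDeg : ∀ {k} → Trigraph k → Fin k → ℕ
redDeg T x = count (λ y → isRed (edge T x y))

-- T' is obtained from T by contracting two distinct vertices u, v.
-- φ maps the vertices of T to those of T': u and v go to the new vertex
-- z = φ u = φ v, all other vertices are kept (injectively).
Contracts : ∀ {k} → Trigraph (suc k) → Trigraph k → Set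
Contracts {k} T T' =
  Σ (Fin (suc k)) λ u → Σ (Fin (suc k)) λ v → u ≢ v ×
  Σ (Fin (suc k) → Fin k) λ φ →
    (φ u ≡ φ v) ×
    (∀ x y → φ x ≡ φ y → x ≡ y ⊎ ((x ≡ u ⊎ x ≡ v) × (y ≡ u ⊎ y ≡ v))) ×
    (∀ (w : Fin k) → ∃ λ x → φ x ≡ w) ×
    (∀ x y → x ≢ u → x ≢ v → y ≢ u → y ≢ v → edge T' (φ x) (φ y) ≡ edge T x y) ×
    (∀ x → x ≢ u → x ≢ v → edge T' (φ u) (φ x) ≡ merge (edge T u x) (edge T v x))

-- A d-sequence of an n-vertex graph G, n = suc m.  tg j is the trigraph
-- G_{j+1} (with j+1 vertices), for j ≤ m; values for j > m are irrelevant.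
record Sequence (m : ℕ) (G : Graph (suc m)) (d : ℕ) : Set where
  field
    tg      : (j : ℕ) → Trigraph (suc j)
    tg-top  : ∀ x y → edge (tg m) x y ≡ toTri G x y
    tg-step : ∀ j → j < m → Contracts (tg (suc j)) (tg j)
    tg-deg  : ∀ j → j ≤ m → ∀ x → redDeg (tg j) x ≤ d
open Sequence public

HasTwinWidth : ∀ {m} → Graph (suc m) → ℕ → Set
HasTwinWidth {m} G d = Sequence m G d × (∀ d' → Sequence m G d' → d ≤ d')

NoRedEdge : ∀ {k} → Trigraph k → Set
NoRedEdge T = ∀ x y → edge T x y ≢ red

ExactlyOneRedEdge : ∀ {k} → Trigraph k → Set
ExactlyOneRedEdge T =
  ∃ λ x → ∃ λ y → edge T x y ≡ red ×
    (∀ a b → edge T a b ≡ red → (a ≡ x × b ≡ y) ⊎ (a ≡ y × b ≡ x))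

{-# OPTIONS --safe #-}
-- Follow the sequence while remembering which vertices of G each vertex of G_i stands for:
-- a non-red edge of G_i then records the (homogeneous) adjacency in G between the two parts.
-- A vertex without red edges therefore has a module of G as its part, so in a prime graph every
-- contracted vertex, whose part has at least two elements, keeps a red edge; this gives a red edge
-- in each G_i with 1 < i < n.  Conversely, red degree at most 1 makes the red edges a matching,
-- and one checks that a contraction never destroys a second red edge: if both red edges touch the
-- contracted pair, the new vertex inherits two red neighbours.  So two red edges would survive down
-- to G_2, which has only one pair of vertices.
module Submission where

open import Defs
open import Data.Nat using (ℕ; zero; suc; _+_; _∸_; _≤_; _<_; z≤n; s≤s; s≤s⁻¹)
open import Data.Nat.Properties using (≤-trans; n≤1+n; m∸n+n≡m; +-suc; m≤n+m)
open import Data.Fin using (Fin; zero; suc; punchIn)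
open import Data.Fin.Properties using (_≟_; any?; punchInᵢ≢i)
open import Data.Bool using (Bool; true; false)
open import Data.Product using (∃; ∃₂; _×_; _,_; proj₁; proj₂)
open import Data.Sum using (_⊎_; inj₁; inj₂; swap)
open import Data.Empty using (⊥; ⊥-elim)
open import Function using (id; _∘_)
open import Relation.Nullary using (¬_; Dec; yes; no; does; contradiction)
open import Relation.Nullary.Decidable using (dec-true; _×-dec_; _⊎-dec_)
open import Relation.Binary.PropositionalEquality
  using (_≡_; _≢_; refl; sym; trans; cong; subst)

does-true : ∀ {a} {A : Set a} (a? : Dec A) → does a? ≡ true → A
does-true (yes a) _ = a

count-pos : ∀ {k} (f : Fin k → Bool) {x} → f x ≡ true → 1 ≤ count f
count-pos {suc k} f {zero} fx with f zero
... | true  = s≤s z≤n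
... | false = contradiction fx λ ()
count-pos {suc k} f {suc x} fx with f zero
... | true  = s≤s z≤n
... | false = count-pos (f ∘ suc) fx

count≤1-unique : ∀ {k} (f : Fin k → Bool) → count f ≤ 1 →
  ∀ {x y} → f x ≡ true → f y ≡ true → x ≡ y
count≤1-unique {suc k} f c≤1 {zero} {zero} _ _ = refl
count≤1-unique {suc k} f c≤1 {zero} {suc y} fx fy with f zero
... | true  = contradiction (≤-trans (count-pos (f ∘ suc) fy) (s≤s⁻¹ c≤1)) λ ()
... | false = contradiction fx λ ()
count≤1-unique {suc k} f c≤1 {suc x} {zero} fx fy with f zero
... | true  = contradiction (≤-trans (count-pos (f ∘ suc) fx) (s≤s⁻¹ c≤1)) λ ()
... | false = contradiction fy λ ()
count≤1-unique {suc k} f c≤1 {suc x} {suc y} fx fy with f zero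
... | true  = contradiction (≤-trans (count-pos (f ∘ suc) fx) (s≤s⁻¹ c≤1)) λ ()
... | false = cong suc (count≤1-unique (f ∘ suc) c≤1 fx fy)

infix 4 _∈⦅_,_⦆

_∈⦅_,_⦆ : ∀ {k} → Fin k → Fin k → Fin k → Set
x ∈⦅ a , b ⦆ = x ≡ a ⊎ x ≡ b

∈⦅⦆-pigeonhole : ∀ {k} {u v a b c : Fin k} →
  a ∈⦅ u , v ⦆ → b ∈⦅ u , v ⦆ → a ≢ b → c ∈⦅ u , v ⦆ → c ∈⦅ a , b ⦆
∈⦅⦆-pigeonhole (inj₁ refl) (inj₁ refl) a≢b _  = contradiction refl a≢b
∈⦅⦆-pigeonhole (inj₂ refl) (inj₂ refl) a≢b _  = contradiction refl a≢b
∈⦅⦆-pigeonhole (inj₁ refl) (inj₂ refl) _   c∈ = c∈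
∈⦅⦆-pigeonhole (inj₂ refl) (inj₁ refl) _   c∈ = swap c∈

SamePair : ∀ {k} → Fin k → Fin k → Fin k → Fin k → Set
SamePair a b c d = (c ≡ a × d ≡ b) ⊎ (c ≡ b × d ≡ a)

samePair? : ∀ {k} (a b c d : Fin k) → Dec (SamePair a b c d)
samePair? a b c d = ((c ≟ a) ×-dec (d ≟ b)) ⊎-dec ((c ≟ b) ×-dec (d ≟ a))

distinct-pairs-Fin2 : ∀ {a b c d : Fin 2} → a ≢ b → c ≢ d → SamePair a b c d
distinct-pairs-Fin2 {zero}     {zero}     a≢b _ = contradiction refl a≢b
distinct-pairs-Fin2 {suc zero} {suc zero} a≢b _ = contradiction refl a≢b
distinct-pairs-Fin2 {c = zero}     {zero}     _ c≢d = contradiction refl c≢d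
distinct-pairs-Fin2 {c = suc zero} {suc zero} _ c≢d = contradiction refl c≢d
distinct-pairs-Fin2 {zero}     {suc zero} {zero}     {suc zero} _ _ = inj₁ (refl , refl)
distinct-pairs-Fin2 {zero}     {suc zero} {suc zero} {zero}     _ _ = inj₂ (refl , refl)
distinct-pairs-Fin2 {suc zero} {zero}     {zero}     {suc zero} _ _ = inj₂ (refl , refl)
distinct-pairs-Fin2 {suc zero} {zero}     {suc zero} {zero}     _ _ = inj₁ (refl , refl)

Disjoint : ∀ {k} → Fin k → Fin k → Fin k → Fin k → Set
Disjoint a b c d = ∀ {x} → x ∈⦅ a , b ⦆ → x ∈⦅ c , d ⦆ → ⊥

infix 4 _isRedOr_

_isRedOr_ : EdgeType → EdgeType → Set
e isRedOr t = e ≡ red ⊎ e ≡ t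

red? : (e : EdgeType) → Dec (e ≡ red)
red? none  = no λ ()
red? black = no λ ()
red? red   = yes refl

merge-redʳ : ∀ e → merge e red ≡ red
merge-redʳ none  = refl
merge-redʳ black = refl
merge-redʳ red   = refl

merge-isRedOr₁ : ∀ e₁ e₂ → merge e₁ e₂ isRedOr e₁
merge-isRedOr₁ none  none  = inj₂ refl
merge-isRedOr₁ black black = inj₂ refl
merge-isRedOr₁ none  black = inj₁ refl
merge-isRedOr₁ none  red   = inj₁ refl
merge-isRedOr₁ black none  = inj₁ refl
merge-isRedOr₁ black red   = inj₁ refl
merge-isRedOr₁ red   _     = inj₁ refl

merge-isRedOr₂ : ∀ e₁ e₂ → merge e₁ e₂ isRedOr e₂
merge-isRedOr₂ none  none  = inj₂ refl
merge-isRedOr₂ black black = inj₂ refl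
merge-isRedOr₂ none  black = inj₁ refl
merge-isRedOr₂ none  red   = inj₁ refl
merge-isRedOr₂ black none  = inj₁ refl
merge-isRedOr₂ black red   = inj₁ refl
merge-isRedOr₂ red   _     = inj₁ refl

merge-isRedOrˡ : ∀ {e₁ e₂ t} → e₁ isRedOr t → merge e₁ e₂ isRedOr t
merge-isRedOrˡ (inj₁ refl) = inj₁ refl
merge-isRedOrˡ {e₁} {e₂} (inj₂ refl) = merge-isRedOr₁ e₁ e₂

merge-isRedOrʳ : ∀ {e₁ e₂ t} → e₂ isRedOr t → merge e₁ e₂ isRedOr t
merge-isRedOrʳ {e₁} (inj₁ refl) = inj₁ (merge-redʳ e₁)
merge-isRedOrʳ {e₁} {e₂} (inj₂ refl) = merge-isRedOr₂ e₁ e₂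

toTri≢red : ∀ {n} (G : Graph n) x y → toTri G x y ≢ red
toTri≢red G x y with adj G x y
... | true  = λ ()
... | false = λ ()

toTri-adj : ∀ {n} (G : Graph n) {x y x′ y′} →
  toTri G x y ≡ toTri G x′ y′ → adj G x y ≡ adj G x′ y′
toTri-adj G {x} {y} {x′} {y′} with adj G x y | adj G x′ y′
... | true  | true  = λ _ → refl
... | false | false = λ _ → refl
... | true  | false = λ ()
... | false | true  = λ ()

module _ {k} (T : Trigraph k) where

  red-sym : ∀ {a b} → edge T a b ≡ red → edge T b a ≡ red
  red-sym {a} {b} = trans (edge-sym T b a)

  isRedOr-sym : ∀ {a b t} → edge T a b isRedOr t → edge T b a isRedOr t
  isRedOr-sym {a} {b} = subst (_isRedOr _) (edge-sym T a b)

  red-irrefl : ∀ {a b} → edge T a b ≡ red → a ≢ b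
  red-irrefl {a} e refl with trans (sym e) (edge-irr T a)
  ... | ()

  red-neighbour-unique : ∀ {a b c} → redDeg T a ≤ 1 →
    edge T a b ≡ red → edge T a c ≡ red → b ≡ c
  red-neighbour-unique deg eb ec = count≤1-unique _ deg (cong isRed eb) (cong isRed ec)

  TwoRedEdges : Set
  TwoRedEdges = ∃₂ λ a b → ∃₂ λ c d →
    edge T a b ≡ red × edge T c d ≡ red × ¬ SamePair a b c d

  exactlyOneRedEdge : ¬ TwoRedEdges → ∀ {a b} → edge T a b ≡ red → ExactlyOneRedEdge T
  exactlyOneRedEdge ¬two {a} {b} eab = a , b , eab , only
    where
    only : ∀ c d → edge T c d ≡ red → SamePair a b c d
    only c d ecd with samePair? a b c d
    ... | yes same  = same
    ... | no ¬same = contradiction (a , b , c , d , eab , ecd , ¬same) ¬two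

  red-edges-disjoint : (∀ x → redDeg T x ≤ 1) → ∀ {a b c d} →
    edge T a b ≡ red → edge T c d ≡ red → ¬ SamePair a b c d → Disjoint a b c d
  red-edges-disjoint deg eab ecd ¬same (inj₁ refl) (inj₁ refl) =
    ¬same (inj₁ (refl , red-neighbour-unique (deg _) ecd eab))
  red-edges-disjoint deg eab ecd ¬same (inj₁ refl) (inj₂ refl) =
    ¬same (inj₂ (red-neighbour-unique (deg _) (red-sym ecd) eab , refl))
  red-edges-disjoint deg eab ecd ¬same (inj₂ refl) (inj₁ refl) =
    ¬same (inj₂ (refl , red-neighbour-unique (deg _) ecd (red-sym eab)))
  red-edges-disjoint deg eab ecd ¬same (inj₂ refl) (inj₂ refl) =
    ¬same (inj₁ (red-neighbour-unique (deg _) (red-sym ecd) (red-sym eab) , refl))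

noRedEdge-Fin1 : (T : Trigraph 1) → NoRedEdge T
noRedEdge-Fin1 T zero zero e = red-irrefl T e refl

¬twoRedEdges-Fin2 : (T : Trigraph 2) → ¬ TwoRedEdges T
¬twoRedEdges-Fin2 T (a , b , c , d , eab , ecd , ¬same) =
  ¬same (distinct-pairs-Fin2 (red-irrefl T eab) (red-irrefl T ecd))

record Contraction {k} (T : Trigraph (suc k)) (T′ : Trigraph k) : Set where
  field
    u v          : Fin (suc k)
    u≢v          : u ≢ v
    φ            : Fin (suc k) → Fin k
    φu≡φv        : φ u ≡ φ v
    φ-fibres     : ∀ x y → φ x ≡ φ y → x ≡ y ⊎ (x ∈⦅ u , v ⦆ × y ∈⦅ u , v ⦆)
    φ-surjective : ∀ w → ∃ λ x → φ x ≡ w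
    edge-kept    : ∀ x y → x ≢ u → x ≢ v → y ≢ u → y ≢ v → edge T′ (φ x) (φ y) ≡ edge T x y
    edge-merged  : ∀ x → x ≢ u → x ≢ v →
                   edge T′ (φ u) (φ x) ≡ merge (edge T u x) (edge T v x)

  z : Fin k
  z = φ u

  Touches : Fin (suc k) → Set
  Touches x = x ∈⦅ u , v ⦆

  touches? : ∀ x → Dec (Touches x)
  touches? x = (x ≟ u) ⊎-dec (x ≟ v)

  φ-touches : ∀ {x} → Touches x → φ x ≡ z
  φ-touches (inj₁ refl) = refl
  φ-touches (inj₂ refl) = sym φu≡φv

  z≢φ : ∀ {x} → ¬ Touches x → z ≢ φ x
  z≢φ {x} ¬tx e with φ-fibres u x e
  ... | inj₁ refl      = ¬tx (inj₁ refl)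
  ... | inj₂ (_ , tx) = ¬tx tx

  φ-injective-outside : ∀ {x y} → ¬ Touches x → x ≢ y → φ x ≢ φ y
  φ-injective-outside {x} {y} ¬tx x≢y e with φ-fibres x y e
  ... | inj₁ x≡y      = x≢y x≡y
  ... | inj₂ (tx , _) = ¬tx tx

  edge-outside : ∀ {x y} → ¬ Touches x → ¬ Touches y → edge T′ (φ x) (φ y) ≡ edge T x y
  edge-outside ¬tx ¬ty = edge-kept _ _ (¬tx ∘ inj₁) (¬tx ∘ inj₂) (¬ty ∘ inj₁) (¬ty ∘ inj₂)

  edge-z : ∀ {x} → ¬ Touches x → edge T′ z (φ x) ≡ merge (edge T u x) (edge T v x)
  edge-z ¬tx = edge-merged _ (¬tx ∘ inj₁) (¬tx ∘ inj₂)

  red-at-z : ∀ {a x} → Touches a → ¬ Touches x → edge T a x ≡ red → edge T′ z (φ x) ≡ red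
  red-at-z {x = x} (inj₁ refl) ¬tx e = trans (edge-z ¬tx) (cong (λ e₁ → merge e₁ (edge T v x)) e)
  red-at-z {x = x} (inj₂ refl) ¬tx e =
    trans (edge-z ¬tx) (trans (cong (merge (edge T u x)) e) (merge-redʳ (edge T u x)))

  isRedOr-at-touched : ∀ {a x t} → Touches a → ¬ Touches x →
    edge T a x isRedOr t → edge T′ (φ a) (φ x) isRedOr t
  isRedOr-at-touched (inj₁ refl) ¬tx h =
    subst (_isRedOr _) (sym (edge-z ¬tx)) (merge-isRedOrˡ h)
  isRedOr-at-touched {x = x} (inj₂ refl) ¬tx h =
    subst (λ p → edge T′ p (φ x) isRedOr _) φu≡φv
      (subst (_isRedOr _) (sym (edge-z ¬tx)) (merge-isRedOrʳ h))

  isRedOr-preserved : ∀ {a b t} → φ a ≢ φ b →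
    edge T a b isRedOr t → edge T′ (φ a) (φ b) isRedOr t
  isRedOr-preserved {a} {b} φa≢φb h with touches? a | touches? b
  ... | yes ta  | yes tb  = contradiction (trans (φ-touches ta) (sym (φ-touches tb))) φa≢φb
  ... | yes ta  | no ¬tb = isRedOr-at-touched ta ¬tb h
  ... | no ¬ta | yes tb  = isRedOr-sym T′ (isRedOr-at-touched tb ¬ta (isRedOr-sym T h))
  ... | no ¬ta | no ¬tb = subst (_isRedOr _) (sym (edge-outside ¬ta ¬tb)) h

  kept-red-edge : ∀ {a b w} → ¬ Touches a → ¬ Touches b →
    edge T a b ≡ red → edge T′ z w ≡ red → TwoRedEdges T′
  kept-red-edge {a} {b} {w} ¬ta ¬tb eab ezw =
    φ a , φ b , z , w , trans (edge-outside ¬ta ¬tb) eab , ezw , z-apart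
    where
    z-apart : ¬ SamePair (φ a) (φ b) z w
    z-apart (inj₁ (z≡φa , _)) = z≢φ ¬ta z≡φa
    z-apart (inj₂ (z≡φb , _)) = z≢φ ¬tb z≡φb

  -- Each edge has only its own endpoint in {u, v}; the other two endpoints have distinct images.
  touching-red-edges : redDeg T′ z ≤ 1 → ∀ {a b c d} →
    edge T a b ≡ red → edge T c d ≡ red → Touches a → Touches c → Disjoint a b c d → ⊥
  touching-red-edges deg {a} {b} {c} {d} eab ecd ta tc disj =
    φ-injective-outside ¬tb (λ b≡d → disj (inj₂ refl) (inj₂ b≡d))
      (red-neighbour-unique T′ deg (red-at-z ta ¬tb eab) (red-at-z tc ¬td ecd))
    where
    ¬tb : ¬ Touches b
    ¬tb tb = disj (∈⦅⦆-pigeonhole ta tb (red-irrefl T eab) tc) (inj₁ refl)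
    ¬td : ¬ Touches d
    ¬td td = disj (inj₁ refl) (∈⦅⦆-pigeonhole tc td (red-irrefl T ecd) ta)

  twoRedEdges-contract : (∀ x → redDeg T x ≤ 1) → redDeg T′ z ≤ 1 →
    ∀ {w} → edge T′ z w ≡ red → TwoRedEdges T → TwoRedEdges T′
  twoRedEdges-contract deg deg′ ezw (a , b , c , d , eab , ecd , ¬same)
    with touches? a ⊎-dec touches? b | touches? c ⊎-dec touches? d
  ... | no ¬tab | _        = kept-red-edge (¬tab ∘ inj₁) (¬tab ∘ inj₂) eab ezw
  ... | yes _    | no ¬tcd = kept-red-edge (¬tcd ∘ inj₁) (¬tcd ∘ inj₂) ecd ezw
  ... | yes tab  | yes tcd  = ⊥-elim (touching tab tcd)
    where
    disj : Disjoint a b c d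
    disj = red-edges-disjoint T deg eab ecd ¬same
    touching : Touches a ⊎ Touches b → Touches c ⊎ Touches d → ⊥
    touching (inj₁ ta) (inj₁ tc) =
      touching-red-edges deg′ eab ecd ta tc disj
    touching (inj₁ ta) (inj₂ td) =
      touching-red-edges deg′ eab (red-sym T ecd) ta td (λ p q → disj p (swap q))
    touching (inj₂ tb) (inj₁ tc) =
      touching-red-edges deg′ (red-sym T eab) ecd tb tc (λ p q → disj (swap p) q)
    touching (inj₂ tb) (inj₂ td) =
      touching-red-edges deg′ (red-sym T eab) (red-sym T ecd) tb td
        (λ p q → disj (swap p) (swap q))

contraction : ∀ {k} {T : Trigraph (suc k)} {T′ : Trigraph k} → Contracts T T′ → Contraction T T′
contraction (u , v , u≢v , φ , φu≡φv , fibres , surjective , kept , merged) = record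
  { u = u ; v = v ; u≢v = u≢v ; φ = φ ; φu≡φv = φu≡φv ; φ-fibres = fibres
  ; φ-surjective = surjective ; edge-kept = kept ; edge-merged = merged }

record Quotient {n k} (G : Graph n) (T : Trigraph k) : Set where
  field
    π            : Fin n → Fin k
    π-surjective : ∀ w → ∃ λ x → π x ≡ w
    π-faithful   : ∀ x y → π x ≢ π y → edge T (π x) (π y) isRedOr toTri G x y

graph-quotient : ∀ {n} {G : Graph n} {T : Trigraph n} →
  (∀ x y → edge T x y ≡ toTri G x y) → Quotient G T
graph-quotient top = record
  { π = id ; π-surjective = λ w → w , refl ; π-faithful = λ x y _ → inj₂ (top x y) }

quotient-contract : ∀ {n k} {G : Graph n} {T : Trigraph (suc k)} {T′ : Trigraph k} →
  Contraction T T′ → Quotient G T → Quotient G T′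
quotient-contract c q = record
  { π            = φ ∘ π
  ; π-surjective = surjective
  ; π-faithful   = λ x y φπx≢φπy →
      isRedOr-preserved φπx≢φπy (π-faithful x y (φπx≢φπy ∘ cong φ))
  }
  where
  open Contraction c
  open Quotient q
  surjective : ∀ w → ∃ λ x → φ (π x) ≡ w
  surjective w with φ-surjective w
  ... | a , φa≡w with π-surjective a
  ... | x , πx≡a = x , trans (cong φ πx≡a) φa≡w

fibre : ∀ {n k} → (Fin n → Fin k) → Fin k → Subset n
fibre π p x = does (π x ≟ p)

fibre-isModule : ∀ {n k} {G : Graph n} {T : Trigraph k} (q : Quotient G T) →
  ∀ p → (∀ w → edge T p w ≢ red) → IsModule G (fibre (Quotient.π q) p)
fibre-isModule {G = G} {T} q p ¬red = inhabited , homogeneous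
  where
  open Quotient q
  inhabited : ∃ λ x → x ∈ₛ fibre π p
  inhabited with π-surjective p
  ... | x , πx≡p = x , dec-true (π x ≟ p) πx≡p
  exact : ∀ y a → π y ≢ p → π a ≡ p → edge T (π y) p ≡ toTri G y a
  exact y a πy≢p πa≡p
    with subst (λ r → edge T (π y) r isRedOr toTri G y a) πa≡p
           (π-faithful y a (λ e → πy≢p (trans e πa≡p)))
  ... | inj₁ e = contradiction (red-sym T e) (¬red (π y))
  ... | inj₂ e = e
  homogeneous : ∀ y → ¬ y ∈ₛ fibre π p → ∀ a b →
    a ∈ₛ fibre π p → b ∈ₛ fibre π p → adj G y a ≡ adj G y b
  homogeneous y y∉ a b a∈ b∈ = toTri-adj G
    (trans (sym (exact y a πy≢p (does-true (π a ≟ p) a∈)))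
           (exact y b πy≢p (does-true (π b ≟ p) b∈)))
    where
    πy≢p : π y ≢ p
    πy≢p = y∉ ∘ dec-true (π y ≟ p)

module _ {n K} {G : Graph n} {T : Trigraph (suc (suc K))} (prime : IsPrime G) (q : Quotient G T)
  where
  open Quotient q

  redless-fibre-subsingleton : ∀ {p} → (∀ w → edge T p w ≢ red) →
    ∀ {x y} → π x ≡ p → π y ≡ p → x ≡ y
  redless-fibre-subsingleton {p} ¬red {x} {y} πx≡p πy≡p
    with prime (fibre π p) (fibre-isModule q p ¬red)
  ... | inj₁ (_ , singleton) =
    trans (proj₁ (singleton x) (dec-true (π x ≟ p) πx≡p))
          (sym (proj₁ (singleton y) (dec-true (π y ≟ p) πy≡p)))
  ... | inj₂ everything =
    contradiction (trans (sym (proj₂ other)) (does-true (π _ ≟ p) (everything (proj₁ other))))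
      (punchInᵢ≢i p zero)
    where
    other : ∃ λ x′ → π x′ ≡ punchIn p zero
    other = π-surjective (punchIn p zero)

-- Otherwise the fibre of z, containing preimages of both u and v, would be a non-trivial module.
contracted-vertex-red : ∀ {n K} {G : Graph n} {T : Trigraph (suc (suc (suc K)))}
  {T′ : Trigraph (suc (suc K))} → IsPrime G → Quotient G T → (c : Contraction T T′) →
  ∃ λ w → edge T′ (Contraction.z c) w ≡ red
contracted-vertex-red {T′ = T′} prime q c = z-red
  where
  open Contraction c
  open Quotient q
  z-red : ∃ λ w → edge T′ z w ≡ red
  z-red with any? (λ w → red? (edge T′ z w))
  ... | yes found = found
  ... | no ¬found with π-surjective u | π-surjective v
  ... | xᵤ , πxᵤ≡u | xᵥ , πxᵥ≡v = contradiction (trans (sym πxᵤ≡u) (trans (cong π xᵤ≡xᵥ) πxᵥ≡v)) u≢v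
    where
    xᵤ≡xᵥ : xᵤ ≡ xᵥ
    xᵤ≡xᵥ = redless-fibre-subsingleton prime (quotient-contract c q) (λ w e → ¬found (w , e))
      (cong φ πxᵤ≡u) (trans (cong φ πxᵥ≡v) (sym φu≡φv))

module _ {m d} {G : Graph (suc m)} (S : Sequence m G d) where

  step-contraction : ∀ k → k < m → Contraction (tg S (suc k)) (tg S k)
  step-contraction k k<m = contraction (tg-step S k k<m)

  sequence-quotient : ∀ k → k ≤ m → Quotient G (tg S k)
  sequence-quotient k k≤m = from-top (m ∸ k) k (m∸n+n≡m k≤m)
    where
    from-top : ∀ δ k → δ + k ≡ m → Quotient G (tg S k)
    from-top zero    k refl   = graph-quotient (tg-top S)
    from-top (suc δ) k δ+k≡m =
      quotient-contract (step-contraction k k<m) (from-top δ (suc k) (trans (+-suc δ k) δ+k≡m))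
      where
      k<m : k < m
      k<m = subst (suc k ≤_) δ+k≡m (s≤s (m≤n+m k δ))

module _ {m} {G : Graph (suc m)} (prime : IsPrime G) (S : Sequence m G 1) where

  step-contraction-red : ∀ j (j<m : suc j < m) →
    ∃ λ w → edge (tg S (suc j)) (Contraction.z (step-contraction S (suc j) j<m)) w ≡ red
  step-contraction-red j j<m = contracted-vertex-red prime
    (sequence-quotient S (suc (suc j)) j<m) (step-contraction S (suc j) j<m)

  ¬twoRedEdges : ∀ j → suc j ≤ m → ¬ TwoRedEdges (tg S (suc j))
  ¬twoRedEdges zero    _   = ¬twoRedEdges-Fin2 (tg S 1)
  ¬twoRedEdges (suc j) j<m two =
    ¬twoRedEdges j (≤-trans (n≤1+n _) j<m)
      (twoRedEdges-contract (tg-deg S (suc (suc j)) j<m)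
        (tg-deg S (suc j) (≤-trans (n≤1+n _) j<m) z) (proj₂ (step-contraction-red j j<m)) two)
    where
    c : Contraction (tg S (suc (suc j))) (tg S (suc j))
    c = step-contraction S (suc j) j<m
    open Contraction c

lemma29 : (m : ℕ) (G : Graph (suc m)) → IsPrime G → HasTwinWidth G 1 →
    (S : Sequence m G 1) →
    NoRedEdge (tg S m) × NoRedEdge (tg S 0) ×
    (∀ j → 1 ≤ j → j < m → ExactlyOneRedEdge (tg S j))
lemma29 m G prime _ S =
  (λ x y e → toTri≢red G x y (trans (sym (tg-top S x y)) e)) ,
  noRedEdge-Fin1 (tg S 0) ,
  exactlyOne
  where
  exactlyOne : ∀ j → 1 ≤ j → j < m → ExactlyOneRedEdge (tg S j)
  exactlyOne (suc j) _ j<m =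
    exactlyOneRedEdge (tg S (suc j)) (¬twoRedEdges prime S j (≤-trans (n≤1+n _) j<m))
      (proj₂ (step-contraction-red prime S j j<m))
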